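{- Let $d\ge1$, $m=\left[\frac{d-1}{2}\right]$, and $N=-1$ if $d$ is even, $N=m$ if $d$ is odd. Then $$h^{(d)}_{0,d}\le h^{(d)}_{0,d-1}\le\cdots\le h^{(d)}_{0,-1}\le h^{(d)}_{1,d}\le\cdots\le h^{(d)}_{1,-1}\le\cdots\le h^{(d)}_{m,d}\le h^{(d)}_{m,d-1}\le\cdots\le h^{(d)}_{m,N},$$ i.e., for each row index $i=0,1,\dots,m$ in turn the entries $h^{(d)}_{i,j}$ are listed with $j$ decreasing from $d$ to $-1$ (to $N$ for the last row $i=m$), and the resulting sequence is weakly increasing.
   Context: $[x]$ is the integer part. For $n\ge1$ and a permutation $\sigma$ of $[n]$, $\mathrm{des}(\sigma)=\#\{1\le i\le n-1:\sigma(i)>\sigma(i+1)\}$; $A(n,i,j)$ is the number of permutations $\sigma$ of $[n]$ with $\sigma(1)=j$ and $\mathrm{des}(\sigma)=i$ (zero if $i\le-1$). For $-1\le i,j\le d$, $h^{(d)}_{i,j}=A(d+2,i+1,j+2)$. -}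

module Defs where

open import Data.Bool using (Bool; true; false; _∧_; if_then_else_)
open import Data.Nat using (ℕ; zero; suc; _+_; _∸_; _<ᵇ_; _≡ᵇ_; _/_)
open import Data.Nat.Properties using (_≟_)
open import Data.Integer as ℤ using (ℤ; +_; -[1+_])
open import Data.List using (List; []; _∷_; _++_; map; concatMap; concat; applyUpTo; downFrom; take; length; filter; filterᵇ; upTo)
open import Data.List.Relation.Unary.Unique.DecPropositional _≟_ using (unique?)
open import Relation.Nullary.Decidable using (does)

words : ℕ → ℕ → List (List ℕ)
words zero    n = [] ∷ []
words (suc k) n = concatMap (λ x → map (x ∷_) (words k n)) (applyUpTo suc n)

-- Permutations σ of [n] = {1,…,n}, in one-line notation σ(1) σ(2) … σ(n):
-- words of length n over [n] with pairwise distinct letters.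
perms : ℕ → List (List ℕ)
perms n = filter unique? (words n n)

des : List ℕ → ℕ
des []           = 0
des (x ∷ [])     = 0
des (x ∷ y ∷ r)  = (if y <ᵇ x then 1 else 0) + des (y ∷ r)

firstIs : ℕ → List ℕ → Bool
firstIs j []      = false
firstIs j (x ∷ _) = x ≡ᵇ j

Aℕ : ℕ → ℕ → ℕ → ℕ
Aℕ n i j = length (filterᵇ (λ σ → firstIs j σ ∧ (des σ ≡ᵇ i)) (perms n))

-- A(n,i,j) for integer i, j (zero if i ≤ -1; also zero if j ≤ -1 since σ(1) ≥ 1)
A : ℕ → ℤ → ℤ → ℕ
A n (+ i)     (+ j)     = Aℕ n i j
A n (+ i)     -[1+ _ ]  = 0
A n -[1+ _ ]  _         = 0

h : ℕ → ℤ → ℤ → ℕ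
h d i j = A (d + 2) (i ℤ.+ + 1) (j ℤ.+ + 2)

mOf : ℕ → ℕ
mOf d = (d ∸ 1) / 2

fullCols : ℕ → List ℤ
fullCols d = map +_ (downFrom (suc d)) ++ (ℤ.- + 1) ∷ []

-- Column indices of the last row i = m: d, d-1, …, N, where
-- N = -1 if d is even and N = m if d is odd.
lastCols : ℕ → List ℤ
lastCols d = if (d Data.Nat.% 2) ≡ᵇ 0 then fullCols d
             else take (suc (d ∸ mOf d)) (fullCols d)

chain : ℕ → List ℕ
chain d = concat (map (λ i → map (h d (+ i)) (fullCols d)) (upTo (mOf d)))
          ++ map (h d (+ mOf d)) (lastCols d)

-- Write E(s, r, a) for the number of permutations of [s + 1] that begin with r + 1 and have a
-- descents, so that h^(d)_{i,j} = E(d + 1, j + 1, i + 1).  Removing the first letter gives a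
-- recurrence for E, and from it: the complement symmetry E(s, r, a) = E(s, s − r, s − a); the
-- identity E(s+1, r+1, a) + E(s, r, a) = E(s+1, r, a) + E(s, r, a − 1); and the row transition
-- E(s+1, 0, a) = E(s+1, s+1, a+1).  An induction on s shows E(s, r, a) ≤ E(s, r, a + 1) whenever
-- 2a + 2 ≤ s, so by the identity E(s+1, ·, a) decreases when 2a ≤ s: this makes each full row
-- increase as j decreases, and consecutive rows meet at equal entries.  In the middle row of odd d
-- the symmetry reduces the remaining half row to the same monotonicity.

module Submission where

open import Defs
open import Algebra.Bundles using (CommutativeMonoid)
open import Data.Bool using (Bool; true; false; _∧_; not; T?; if_then_else_)
open import Data.Bool.ListAction using (all)
open import Data.Bool.Properties using (∧-assoc; ∧-zeroʳ; ∧-identityʳ; ∧-commutativeMonoid)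
open import Data.Integer as ℤ using (ℤ; -[1+_])
open import Data.List
  using (List; []; _∷_; _++_; map; concat; concatMap; applyUpTo; applyDownFrom; upTo; take; length; filter; filterᵇ)
open import Data.List.Properties using (filter-++; length-++; map-applyUpTo; take-map)
open import Data.List.Relation.Unary.All using (all?)
open import Data.List.Relation.Unary.Linked using (Linked; [-]; _∷_; tail)
open import Data.Nat
  using (ℕ; zero; suc; _+_; _*_; _∸_; _≤_; _<_; z≤n; s≤s; z<s; s<s; _<ᵇ_; _≡ᵇ_; _≤?_; _<?_; _%_; _/_)
open import Data.Nat.DivMod using (m≡m%n+[m/n]*n; [m+kn]%n≡m%n; m%n<n; m/n*n≤m)
open import Data.Nat.ListAction using (sum)
open import Data.Nat.Properties
open import Data.List.Relation.Unary.Unique.DecPropositional _≟_ using (unique?)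
open import Data.Product using (_×_; _,_)
open import Data.Sum using (_⊎_; inj₁; inj₂; [_,_]′)
open import Function using (_∘_; id)
open import Relation.Binary.PropositionalEquality
open import Relation.Nullary using (does; yes; no; ¬?; contradiction)
open import Relation.Nullary.Decidable using (toSum)
open import Relation.Nullary.Reflects using (ofʸ; ofⁿ)
open import Relation.Unary using (Pred; Decidable)
open import Algebra.Properties.CommutativeSemigroup (CommutativeMonoid.commutativeSemigroup ∧-commutativeMonoid)
  using (interchange)
import Algebra.Properties.CommutativeSemigroup +-commutativeSemigroup as ℕ+

<ᵇ-true : ∀ {m n} → m < n → (m <ᵇ n) ≡ true
<ᵇ-true {zero}  (s≤s _) = refl
<ᵇ-true {suc m} (s≤s p) = <ᵇ-true p

<ᵇ-false : ∀ {m n} → n ≤ m → (m <ᵇ n) ≡ false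
<ᵇ-false z≤n     = refl
<ᵇ-false (s≤s p) = <ᵇ-false p

<ᵇ-suc : ∀ {t r} → t ≢ r → (t <ᵇ suc r) ≡ (t <ᵇ r)
<ᵇ-suc {zero}  {zero}  t≢r = contradiction refl t≢r
<ᵇ-suc {zero}  {suc r} _   = refl
<ᵇ-suc {suc t} {zero}  _   = refl
<ᵇ-suc {suc t} {suc r} t≢r = <ᵇ-suc (t≢r ∘ cong suc)

≡ᵇ-refl : ∀ n → (n ≡ᵇ n) ≡ true
≡ᵇ-refl zero    = refl
≡ᵇ-refl (suc n) = ≡ᵇ-refl n

≡ᵇ-false : ∀ {m n} → m ≢ n → (m ≡ᵇ n) ≡ false
≡ᵇ-false {zero}  {zero}  m≢n = contradiction refl m≢n
≡ᵇ-false {zero}  {suc n} _   = refl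
≡ᵇ-false {suc m} {zero}  _   = refl
≡ᵇ-false {suc m} {suc n} m≢n = ≡ᵇ-false (m≢n ∘ cong suc)

antitone : ∀ (f : ℕ → ℕ) n → (∀ x → x < n → f (suc x) ≤ f x) →
           ∀ {x y} → x ≤ y → y ≤ n → f y ≤ f x
antitone f n step {y = zero}  z≤n _ = ≤-refl
antitone f n step {y = suc y} x≤y y<n with m≤n⇒m<n∨m≡n x≤y
... | inj₂ refl = ≤-refl
... | inj₁ x<y  = ≤-trans (step y y<n) (antitone f n step (≤-pred x<y) (<⇒≤ y<n))

-- Finite sums

∑ : ℕ → (ℕ → ℕ) → ℕ
∑ n f = sum (applyUpTo f n)

∑-cong : ∀ n {f g} → (∀ t → t < n → f t ≡ g t) → ∑ n f ≡ ∑ n g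
∑-cong zero    eq = refl
∑-cong (suc n) eq = cong₂ _+_ (eq 0 z<s) (∑-cong n (λ t t<n → eq (suc t) (s<s t<n)))

∑-mono : ∀ n {f g} → (∀ t → t < n → f t ≤ g t) → ∑ n f ≤ ∑ n g
∑-mono zero    le = z≤n
∑-mono (suc n) le = +-mono-≤ (le 0 z<s) (∑-mono n (λ t t<n → le (suc t) (s<s t<n)))

∑-zero : ∀ n {f} → (∀ t → t < n → f t ≡ 0) → ∑ n f ≡ 0
∑-zero zero    eq = refl
∑-zero (suc n) eq = cong₂ _+_ (eq 0 z<s) (∑-zero n (λ t t<n → eq (suc t) (s<s t<n)))

∑-mono-length : ∀ {m n} f → m ≤ n → ∑ m f ≤ ∑ n f
∑-mono-length f z≤n       = z≤n
∑-mono-length f (s≤s m≤n) = +-monoʳ-≤ (f 0) (∑-mono-length (f ∘ suc) m≤n)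

∑-suc : ∀ n f → ∑ (suc n) f ≡ ∑ n f + f n
∑-suc zero    f = +-comm (f 0) 0
∑-suc (suc n) f = trans (cong (f 0 +_) (∑-suc n (f ∘ suc))) (sym (+-assoc (f 0) _ _))

∑-+ : ∀ m n f → ∑ (m + n) f ≡ ∑ m f + ∑ n (λ u → f (m + u))
∑-+ zero    n f = refl
∑-+ (suc m) n f = trans (cong (f 0 +_) (∑-+ m n (f ∘ suc))) (sym (+-assoc (f 0) _ _))

∑-split : ∀ r k (f g : ℕ → ℕ) →
          ∑ (r + k) (λ t → if t <ᵇ r then f t else g t) ≡ ∑ r f + ∑ k (λ u → g (r + u))
∑-split r k f g = trans (∑-+ r k _)
  (cong₂ _+_ (∑-cong r (λ t t<r → cong (if_then f t else g t) (<ᵇ-true t<r)))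
             (∑-cong k (λ u _ → cong (if_then f (r + u) else g (r + u)) (<ᵇ-false (m≤m+n r u)))))

∑-reflect : ∀ {n} {f g : ℕ → ℕ} → (∀ t u → suc (t + u) ≡ n → f t ≡ g u) → ∑ n f ≡ ∑ n g
∑-reflect {zero}          eq = refl
∑-reflect {suc n} {f} {g} eq = begin
  f 0 + ∑ n (f ∘ suc) ≡⟨ cong₂ _+_ (eq 0 n refl) (∑-reflect (λ t u e → eq (suc t) u (cong suc e))) ⟩
  g n + ∑ n g         ≡⟨ +-comm (g n) _ ⟩
  ∑ n g + g n         ≡⟨ ∑-suc n g ⟨
  ∑ (suc n) g         ∎
  where open ≡-Reasoning

∑-agree-except : ∀ {n r} (f g : ℕ → ℕ) → r < n → (∀ t → t < n → t ≢ r → f t ≡ g t) →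
                 ∑ n f + g r ≡ ∑ n g + f r
∑-agree-except {suc n} {zero} f g _ agree =
  trans (cong (λ x → f 0 + x + g 0) (∑-cong n (λ t t<n → agree (suc t) (s<s t<n) (λ ()))))
        (ℕ+.xy∙z≈zy∙x (f 0) (∑ n (g ∘ suc)) (g 0))
∑-agree-except {suc n} {suc r} f g (s<s r<n) agree = begin
  f 0 + ∑ n (f ∘ suc) + g (suc r)   ≡⟨ +-assoc (f 0) _ _ ⟩
  f 0 + (∑ n (f ∘ suc) + g (suc r)) ≡⟨ cong₂ _+_ (agree 0 z<s (λ ())) (∑-agree-except (f ∘ suc) (g ∘ suc) r<n
                                         (λ t t<n t≢r → agree (suc t) (s<s t<n) (t≢r ∘ suc-injective))) ⟩
  g 0 + (∑ n (g ∘ suc) + f (suc r)) ≡⟨ +-assoc (g 0) _ _ ⟨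
  g 0 + ∑ n (g ∘ suc) + f (suc r)   ∎
  where open ≡-Reasoning

∑-single : ∀ {n k f} → k < n → (∀ t → t < n → t ≢ k → f t ≡ 0) → ∑ n f ≡ f k
∑-single {suc n} {zero}  {f} _ others =
  trans (cong (f 0 +_) (∑-zero n (λ t t<n → others (suc t) (s<s t<n) (λ ())))) (+-identityʳ (f 0))
∑-single {suc n} {suc k} {f} (s<s k<n) others =
  cong₂ _+_ (others 0 z<s (λ ())) (∑-single k<n (λ t t<n t≢k → others (suc t) (s<s t<n) (t≢k ∘ suc-injective)))

-- Permutations by first letter and number of descents

shift : (ℕ → ℕ) → ℕ → ℕ
shift f zero    = 0
shift f (suc a) = f a

shiftIf : Bool → (ℕ → ℕ) → ℕ → ℕ
shiftIf b f a = if b then shift f a else f a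

shiftIf-cong : ∀ {b b′ f g} → b ≡ b′ → (∀ j → f j ≡ g j) → ∀ i → shiftIf b f i ≡ shiftIf b′ g i
shiftIf-cong {true}  refl eq zero    = refl
shiftIf-cong {true}  refl eq (suc i) = eq i
shiftIf-cong {false} refl eq i       = eq i

-- Eul s r a counts the permutations of [s + 1] beginning with r + 1 that have a descents (the
-- value is meaningless for r > s).  Deleting the first letter and standardising leaves a
-- permutation of [s] beginning with some t + 1, and a descent is lost exactly when t < r.
Eul : ℕ → ℕ → ℕ → ℕ
Eul zero    r zero    = 1
Eul zero    r (suc a) = 0
Eul (suc s) r a       = ∑ (suc s) (λ t → shiftIf (t <ᵇ r) (Eul s t) a)

Eul-vanish : ∀ s r {a} → s < a → Eul s r a ≡ 0
Eul-vanish zero    r {suc a} _         = refl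
Eul-vanish (suc s) r {suc a} (s<s s<a) = ∑-zero (suc s) term
  where
  term : ∀ t → t < suc s → shiftIf (t <ᵇ r) (Eul s t) (suc a) ≡ 0
  term t _ with t <ᵇ r
  ... | true  = Eul-vanish s t s<a
  ... | false = Eul-vanish s t (m<n⇒m<1+n s<a)

Eul-complement : ∀ {s} r r′ a a′ → r + r′ ≡ s → a + a′ ≡ s → Eul s r a ≡ Eul s r′ a′
Eul-complement {zero}  r r′ zero zero _ _       = refl
Eul-complement {suc s} r r′ a a′ r+r′≡ a+a′≡ = ∑-reflect term
  where
  shifted : ∀ t u b b′ → t + u ≡ s → b + b′ ≡ suc s → shift (Eul s t) b ≡ Eul s u b′
  shifted t u zero    b′ _   b+b′ = sym (Eul-vanish s u (≤-reflexive (sym b+b′)))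
  shifted t u (suc b) b′ t+u b+b′ = Eul-complement t u b b′ t+u (suc-injective b+b′)
  -- As t + u + 1 = r + r′, exactly one of t < r and u < r′ holds.
  term : ∀ t u → suc (t + u) ≡ suc s → shiftIf (t <ᵇ r) (Eul s t) a ≡ shiftIf (u <ᵇ r′) (Eul s u) a′
  term t u eq with t <ᵇ r | <ᵇ-reflects-< t r | u <ᵇ r′ | <ᵇ-reflects-< u r′
  ... | true  | ofʸ t<r | false | ofⁿ _    = shifted t u a a′ (suc-injective eq) a+a′≡
  ... | false | ofⁿ _   | true  | ofʸ u<r′ =
    sym (shifted u t a′ a (trans (+-comm u t) (suc-injective eq)) (trans (+-comm a′ a) a+a′≡))
  ... | true  | ofʸ t<r | true  | ofʸ u<r′ =
    contradiction (subst₂ _≤_ (cong suc (+-suc t u)) (trans r+r′≡ (sym eq)) (+-mono-≤ t<r u<r′)) (<-irrefl refl)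
  ... | false | ofⁿ t≮r | false | ofⁿ u≮r′ =
    contradiction (subst (_≤ t + u) (trans r+r′≡ (sym eq)) (+-mono-≤ (≮⇒≥ t≮r) (≮⇒≥ u≮r′))) (<-irrefl refl)

Eul-split : ∀ s r k a → r + k ≡ suc s →
            Eul (suc s) r a ≡ ∑ r (λ t → shift (Eul s t) a) + ∑ k (λ u → Eul s (r + u) a)
Eul-split s r k a r+k≡ =
  trans (cong (λ n → ∑ n (λ t → shiftIf (t <ᵇ r) (Eul s t) a)) (sym r+k≡))
        (∑-split r k (λ t → shift (Eul s t) a) (λ t → Eul s t a))

Eul-first-suc : ∀ s r a → r ≤ s → Eul (suc s) (suc r) a + Eul s r a ≡ Eul (suc s) r a + shift (Eul s r) a
Eul-first-suc s r a r≤s = begin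
  Eul (suc s) (suc r) a + Eul s r a
    ≡⟨ cong (λ b → Eul (suc s) (suc r) a + shiftIf b (Eul s r) a) (<ᵇ-false (≤-refl {r})) ⟨
  ∑ (suc s) (term (suc r)) + term r r
    ≡⟨ ∑-agree-except (term (suc r)) (term r) (s≤s r≤s)
         (λ t _ t≢r → cong (λ b → shiftIf b (Eul s t) a) (<ᵇ-suc t≢r)) ⟩
  ∑ (suc s) (term r) + term (suc r) r
    ≡⟨ cong (λ b → Eul (suc s) r a + shiftIf b (Eul s r) a) (<ᵇ-true (≤-refl {suc r})) ⟩
  Eul (suc s) r a + shift (Eul s r) a
    ∎
  where
  open ≡-Reasoning
  term : ℕ → ℕ → ℕ
  term q t = shiftIf (t <ᵇ q) (Eul s t) a

Eul-first≡last : ∀ s a → Eul (suc s) 0 a ≡ Eul (suc s) (suc s) (suc a)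
Eul-first≡last s a = ∑-cong (suc s) (λ t t≤s → sym (cong (λ b → shiftIf b (Eul s t) (suc a)) (<ᵇ-true t≤s)))

Eul-decreasing-step : ∀ s x a → x ≤ s → shift (Eul s x) a ≤ Eul s x a → Eul (suc s) (suc x) a ≤ Eul (suc s) x a
Eul-decreasing-step s x a x≤s le =
  +-cancelʳ-≤ _ _ _ (≤-trans (≤-reflexive (Eul-first-suc s x a x≤s)) (+-monoʳ-≤ (Eul (suc s) x a) le))

-- For s + 1 = 2a + 1 the counts with a + 1 descents mirror those with a descents, so the tails
-- cannot be compared termwise; instead the first sum is pushed down to ∑ k (Eul (suc s) · a),
-- which is the second sum read backwards.
Eul-middle-tail : ∀ s a r k → s ≡ a + a → r + k ≡ suc (suc s) →
                  (∀ x → x < suc s → Eul (suc s) (suc x) a ≤ Eul (suc s) x a) →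
                  ∑ k (λ u → Eul (suc s) (r + u) a) ≤ ∑ k (λ u → Eul (suc s) (r + u) (suc a))
Eul-middle-tail s a r k s≡a+a r+k≡ decreasing = begin
  ∑ k (λ u → Eul (suc s) (r + u) a)
    ≤⟨ ∑-mono k (λ u u<k → antitone (λ x → Eul (suc s) x a) (suc s) decreasing (m≤n+m u r) (r+u≤ u<k)) ⟩
  ∑ k (λ u → Eul (suc s) u a)
    ≡⟨ ∑-reflect (λ u v eq → Eul-complement u (r + v) a (suc a) (u+[r+v]≡ u v eq) a+1+a≡) ⟩
  ∑ k (λ v → Eul (suc s) (r + v) (suc a))
    ∎
  where
  open ≤-Reasoning
  r+u≤ : ∀ {u} → u < k → r + u ≤ suc s
  r+u≤ {u} u<k = ≤-pred (subst (r + u <_) r+k≡ (+-monoʳ-< r u<k))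
  u+[r+v]≡ : ∀ u v → suc (u + v) ≡ k → u + (r + v) ≡ suc s
  u+[r+v]≡ u v eq = suc-injective (begin-equality
    suc (u + (r + v)) ≡⟨ cong suc (ℕ+.x∙yz≈y∙xz u r v) ⟩
    suc (r + (u + v)) ≡⟨ +-suc r (u + v) ⟨
    r + suc (u + v)   ≡⟨ cong (r +_) eq ⟩
    r + k             ≡⟨ r+k≡ ⟩
    suc (suc s)       ∎)
  a+1+a≡ : a + suc a ≡ suc s
  a+1+a≡ = trans (+-suc a a) (cong suc (sym s≡a+a))

Eul-increasing-in-descents : ∀ s a r → 2 + (a + a) ≤ s → r ≤ s → Eul s r a ≤ Eul s r (suc a)
shift-Eul-increasing : ∀ s a t → a + a ≤ s → t ≤ s → shift (Eul s t) a ≤ Eul s t a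
Eul-increasing-tail : ∀ s a r k → suc (a + a) ≤ s → r + k ≡ suc s →
                      ∑ k (λ u → Eul s (r + u) a) ≤ ∑ k (λ u → Eul s (r + u) (suc a))

shift-Eul-increasing s zero    t _ _   = z≤n
shift-Eul-increasing s (suc a) t h t≤s = Eul-increasing-in-descents s a t (subst (_≤ s) (cong suc (+-suc a a)) h) t≤s

Eul-increasing-in-descents (suc s) a r h r≤ = begin
  Eul (suc s) r a                                                           ≡⟨ Eul-split s r k a r+k≡ ⟩
  ∑ r (λ t → shift (Eul s t) a) + ∑ k (λ u → Eul s (r + u) a)             ≤⟨ +-mono-≤ heads tails ⟩
  ∑ r (λ t → shift (Eul s t) (suc a)) + ∑ k (λ u → Eul s (r + u) (suc a)) ≡⟨ Eul-split s r k (suc a) r+k≡ ⟨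
  Eul (suc s) r (suc a)                                                     ∎
  where
  open ≤-Reasoning
  k = suc s ∸ r
  r+k≡ : r + k ≡ suc s
  r+k≡ = m+[n∸m]≡n r≤
  heads : ∑ r (λ t → shift (Eul s t) a) ≤ ∑ r (λ t → shift (Eul s t) (suc a))
  heads = ∑-mono r (λ t t<r → shift-Eul-increasing s a t (<⇒≤ (≤-pred h)) (≤-pred (≤-trans t<r r≤)))
  tails : ∑ k (λ u → Eul s (r + u) a) ≤ ∑ k (λ u → Eul s (r + u) (suc a))
  tails = Eul-increasing-tail s a r k (≤-pred h) r+k≡

-- Both cases are lambdas rather than 'with'/'where' clauses so that the termination checker sees
-- the recursive calls at argument suc s itself.
Eul-increasing-tail (suc s) a r k h r+k≡ =
  [ (λ h′ → ∑-mono k (λ u u<k →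
      Eul-increasing-in-descents (suc s) a (r + u) h′ (≤-pred (subst (r + u <_) r+k≡ (+-monoʳ-< r u<k)))))
  , (λ h′ → Eul-middle-tail s a r k (≤-antisym (≤-pred (≤-pred (≰⇒> h′))) (≤-pred h)) r+k≡ (λ x x<1+s →
      Eul-decreasing-step s x a (≤-pred x<1+s) (shift-Eul-increasing s a x (≤-pred h) (≤-pred x<1+s))))
  ]′ (toSum (2 + (a + a) ≤? suc s))

Eul-decreasing-in-first : ∀ s a → a + a ≤ s → ∀ x → x < suc s → Eul (suc s) (suc x) a ≤ Eul (suc s) x a
Eul-decreasing-in-first s a h x x<1+s =
  Eul-decreasing-step s x a (≤-pred x<1+s) (shift-Eul-increasing s a x h (≤-pred x<1+s))

Eul-decreasing-in-first-middle : ∀ m {k} → suc m ≤ k → k ≤ suc (m + m) →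
                                 Eul (2 + (m + m)) (suc k) (suc m) ≤ Eul (2 + (m + m)) k (suc m)
Eul-decreasing-in-first-middle m {k} m<k k≤d with m≤n⇒∃[o]m+o≡n k≤d
... | k′ , k+k′≡d = Eul-decreasing-step d k (suc m) k≤d (begin
  Eul d k m       ≤⟨ antitone (λ x → Eul d x m) d (Eul-decreasing-in-first (m + m) m ≤-refl) k′≤k k≤d ⟩
  Eul d k′ m      ≡⟨ Eul-complement k k′ (suc m) m k+k′≡d refl ⟨
  Eul d k (suc m) ∎)
  where
  open ≤-Reasoning
  d = suc (m + m)
  k′≤k : k′ ≤ k
  k′≤k = ≤-trans (+-cancelˡ-≤ (suc m) k′ m (≤-trans (+-monoˡ-≤ k′ m<k) (≤-reflexive k+k′≡d))) (<⇒≤ m<k)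

count : (List ℕ → Bool) → List (List ℕ) → ℕ
count p ws = length (filterᵇ p ws)

count-++ : ∀ p xs ys → count p (xs ++ ys) ≡ count p xs + count p ys
count-++ p xs ys = trans (cong length (filter-++ (T? ∘ p) xs ys)) (length-++ (filterᵇ p xs))

count-concatMap : ∀ {A : Set} p (g : A → List (List ℕ)) xs →
                  count p (concatMap g xs) ≡ sum (map (count p ∘ g) xs)
count-concatMap p g []       = refl
count-concatMap p g (x ∷ xs) = trans (count-++ p (g x) (concatMap g xs)) (cong (count p (g x) +_) (count-concatMap p g xs))

count-map : ∀ p f ws → count p (map f ws) ≡ count (p ∘ f) ws
count-map p f []       = refl
count-map p f (w ∷ ws) with p (f w)
... | true  = cong suc (count-map p f ws)
... | false = count-map p f ws

count-cong : ∀ {p q} → (∀ w → p w ≡ q w) → ∀ ws → count p ws ≡ count q ws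
count-cong eq []       = refl
count-cong {p} {q} eq (w ∷ ws) with p w | q w | eq w
... | true  | .true  | refl = cong suc (count-cong eq ws)
... | false | .false | refl = count-cong eq ws

count-none : ∀ {p} → (∀ w → p w ≡ false) → ∀ ws → count p ws ≡ 0
count-none none []       = refl
count-none none (w ∷ ws) rewrite none w = count-none none ws

count-filter : ∀ {ℓ} {P : Pred (List ℕ) ℓ} (P? : Decidable P) p ws →
               count p (filter P? ws) ≡ count (λ w → does (P? w) ∧ p w) ws
count-filter P? p []       = refl
count-filter P? p (w ∷ ws) with does (P? w)
... | false = count-filter P? p ws
... | true with p w
...   | true  = cong suc (count-filter P? p ws)
...   | false = count-filter P? p ws

count-words-suc : ∀ p k n → count p (words (suc k) n) ≡ ∑ n (λ z → count (λ w → p (suc z ∷ w)) (words k n))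
count-words-suc p k n = begin
  count p (concatMap (λ x → map (x ∷_) (words k n)) (applyUpTo suc n))
    ≡⟨ count-concatMap p (λ x → map (x ∷_) (words k n)) (applyUpTo suc n) ⟩
  sum (map (λ x → count p (map (x ∷_) (words k n))) (applyUpTo suc n))
    ≡⟨ cong sum (map-applyUpTo suc _ n) ⟩
  ∑ n (λ z → count p (map (suc z ∷_) (words k n)))
    ≡⟨ ∑-cong n (λ z _ → count-map p (suc z ∷_) (words k n)) ⟩
  ∑ n (λ z → count (λ w → p (suc z ∷ w)) (words k n))
    ∎
  where open ≡-Reasoning

-- Arrangements of a set of letters

remove : (ℕ → Bool) → ℕ → ℕ → Bool
remove L x y = L y ∧ not (x ≡ᵇ y)

arranged : (ℕ → Bool) → List ℕ → Bool
arranged L []      = true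
arranged L (x ∷ w) = L x ∧ arranged (remove L x) w

arrangedAfter : (ℕ → Bool) → ℕ → ℕ → List ℕ → Bool
arrangedAfter L prev i w = arranged L w ∧ (des (prev ∷ w) ≡ᵇ i)

fresh : ℕ → List ℕ → Bool
fresh x w = does (all? (λ y → ¬? (x ≟ y)) w)

all-remove : ∀ L x w → all (remove L x) w ≡ all L w ∧ fresh x w
all-remove L x []      = refl
all-remove L x (y ∷ w) =
  trans (cong ((L y ∧ not (x ≡ᵇ y)) ∧_) (all-remove L x w)) (interchange (L y) (not (x ≡ᵇ y)) (all L w) (fresh x w))

arranged≡ : ∀ L w → arranged L w ≡ all L w ∧ does (unique? w)
arranged≡ L []      = refl
arranged≡ L (x ∷ w) = begin
  L x ∧ arranged (remove L x) w                    ≡⟨ cong (L x ∧_) (trans (arranged≡ (remove L x) w)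
                                                                           (cong (_∧ does (unique? w)) (all-remove L x w))) ⟩
  L x ∧ ((all L w ∧ fresh x w) ∧ does (unique? w)) ≡⟨ cong (L x ∧_) (∧-assoc (all L w) _ _) ⟩
  L x ∧ (all L w ∧ (fresh x w ∧ does (unique? w))) ≡⟨ ∧-assoc (L x) _ _ ⟨
  (L x ∧ all L w) ∧ (fresh x w ∧ does (unique? w)) ∎
  where open ≡-Reasoning

all-true : ∀ (w : List ℕ) → all (λ _ → true) w ≡ true
all-true []      = refl
all-true (x ∷ w) = all-true w

unique≡arranged : ∀ w → does (unique? w) ≡ arranged (λ _ → true) w
unique≡arranged w = sym (trans (arranged≡ (λ _ → true) w) (cong (_∧ does (unique? w)) (all-true w)))

indicator : Bool → ℕ
indicator b = if b then 1 else 0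

rank : (ℕ → Bool) → ℕ → ℕ
rank L n = ∑ n (λ z → indicator (L (suc z)))

rank-all : ∀ n → rank (λ _ → true) n ≡ n
rank-all zero    = refl
rank-all (suc n) = cong suc (rank-all n)

rank-mono : ∀ L {m n} → m ≤ n → rank L m ≤ rank L n
rank-mono L = ∑-mono-length (λ z → indicator (L (suc z)))

rank-suc : ∀ L z → L (suc z) ≡ true → rank L (suc z) ≡ suc (rank L z)
rank-suc L z Lz = trans (∑-suc z _) (trans (cong (λ b → rank L z + indicator b) Lz) (+-comm (rank L z) 1))

remove-other : ∀ L {x y} → x ≢ y → remove L x y ≡ L y
remove-other L {y = y} x≢y = trans (cong (λ b → L y ∧ not b) (≡ᵇ-false x≢y)) (∧-identityʳ (L y))

rank-remove-below : ∀ L z m → m ≤ z → rank (remove L (suc z)) m ≡ rank L m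
rank-remove-below L z m m≤z =
  ∑-cong m (λ t t<m → cong indicator (remove-other L (λ e → <-irrefl (sym (suc-injective e)) (≤-trans t<m m≤z))))

rank-remove : ∀ L z n → L (suc z) ≡ true → z < n → rank L n ≡ suc (rank (remove L (suc z)) n)
rank-remove L z n Lz z<n = begin
  rank L n       ≡⟨ +-identityʳ _ ⟨
  rank L n + 0   ≡⟨ cong (rank L n +_) f-z≡0 ⟨
  rank L n + f z ≡⟨ ∑-agree-except f g z<n agree ⟨
  rank′ + g z    ≡⟨ cong (λ b → rank′ + indicator b) Lz ⟩
  rank′ + 1      ≡⟨ +-comm rank′ 1 ⟩
  suc rank′      ∎
  where
  open ≡-Reasoning
  f g : ℕ → ℕ
  f t = indicator (remove L (suc z) (suc t))
  g t = indicator (L (suc t))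
  rank′ : ℕ
  rank′ = rank (remove L (suc z)) n
  agree : ∀ t → t < n → t ≢ z → f t ≡ g t
  agree t _ t≢z = cong indicator (remove-other L (t≢z ∘ sym ∘ suc-injective))
  f-z≡0 : f z ≡ 0
  f-z≡0 = cong indicator (trans (cong (λ b → L (suc z) ∧ not b) (≡ᵇ-refl z)) (∧-zeroʳ (L (suc z))))

rank-<ᵇ : ∀ L z prev → L (suc z) ≡ true → (suc z <ᵇ prev) ≡ (rank L z <ᵇ rank L (prev ∸ 1))
rank-<ᵇ L z zero    Lz = refl
rank-<ᵇ L z (suc n) Lz with z <? n
... | yes z<n = trans (<ᵇ-true z<n) (sym (<ᵇ-true (≤-trans (≤-reflexive (sym (rank-suc L z Lz))) (rank-mono L z<n))))
... | no  z≮n = trans (<ᵇ-false (≮⇒≥ z≮n)) (sym (<ᵇ-false (rank-mono L (≮⇒≥ z≮n))))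

∑-rank : ∀ L n (f H : ℕ → ℕ) →
         (∀ z → z < n → L (suc z) ≡ true → f z ≡ H (rank L z)) →
         (∀ z → z < n → L (suc z) ≡ false → f z ≡ 0) →
         ∑ n f ≡ ∑ (rank L n) H
∑-rank L zero    f H present absent = refl
∑-rank L (suc n) f H present absent = by-first-letter (L 1) refl
  where
  present′ : ∀ {b} → L 1 ≡ b → ∀ z → z < n → L (suc (suc z)) ≡ true →
             f (suc z) ≡ H (indicator b + rank (L ∘ suc) z)
  present′ L1 z z<n Lz = trans (present (suc z) (s<s z<n) Lz) (cong (λ b → H (indicator b + rank (L ∘ suc) z)) L1)
  absent′ : ∀ z → z < n → L (suc (suc z)) ≡ false → f (suc z) ≡ 0
  absent′ z z<n = absent (suc z) (s<s z<n)
  by-first-letter : ∀ b → L 1 ≡ b → ∑ (suc n) f ≡ ∑ (indicator b + rank (L ∘ suc) n) H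
  by-first-letter true  L1 = cong₂ _+_ (present 0 z<s L1) (∑-rank (L ∘ suc) n (f ∘ suc) (H ∘ suc) (present′ L1) absent′)
  by-first-letter false L1 = cong₂ _+_ (absent 0 z<s L1) (∑-rank (L ∘ suc) n (f ∘ suc) H (present′ L1) absent′)

count-arrangedAfter-absent : ∀ L prev i x ws → L x ≡ false →
                             count (λ w → arrangedAfter L prev i (x ∷ w)) ws ≡ 0
count-arrangedAfter-absent L prev i x ws Lx =
  count-none (λ w → cong (λ b → (b ∧ arranged (remove L x) w) ∧ (des (prev ∷ x ∷ w) ≡ᵇ i)) Lx) ws

count-arrangedAfter-present : ∀ L prev i x ws → L x ≡ true →
                              count (λ w → arrangedAfter L prev i (x ∷ w)) ws
                                ≡ shiftIf (x <ᵇ prev) (λ j → count (arrangedAfter (remove L x) x j) ws) i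
count-arrangedAfter-present L prev i x ws Lx rewrite Lx with x <ᵇ prev | i
... | false | _     = refl
... | true  | suc j = refl
... | true  | zero  = count-none (λ w → ∧-zeroʳ (arranged (remove L x) w)) ws

-- Only the relative order of prev and the k letters of L matters, and prev has rank
-- rank L (prev ∸ 1) among them: this is the standardisation behind the recurrence for Eul.
count-arrangedAfter : ∀ k L prev i n → rank L n ≡ k →
                      count (arrangedAfter L prev i) (words k n) ≡ Eul k (rank L (prev ∸ 1)) i
count-arrangedAfter zero    L prev zero    n _     = refl
count-arrangedAfter zero    L prev (suc i) n _     = refl
count-arrangedAfter (suc k) L prev i       n rank≡ = begin
  count (arrangedAfter L prev i) (words (suc k) n)         ≡⟨ count-words-suc (arrangedAfter L prev i) k n ⟩
  ∑ n (λ z → count (starting (suc z)) (words k n))         ≡⟨ ∑-rank L n _ term present absent ⟩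
  ∑ (rank L n) term                                        ≡⟨ cong (λ m → ∑ m term) rank≡ ⟩
  Eul (suc k) (rank L (prev ∸ 1)) i                        ∎
  where
  open ≡-Reasoning
  starting : ℕ → List ℕ → Bool
  starting x w = arrangedAfter L prev i (x ∷ w)
  term : ℕ → ℕ
  term t = shiftIf (t <ᵇ rank L (prev ∸ 1)) (Eul k t) i
  present : ∀ z → z < n → L (suc z) ≡ true → count (starting (suc z)) (words k n) ≡ term (rank L z)
  present z z<n Lz = trans (count-arrangedAfter-present L prev i (suc z) (words k n) Lz)
    (shiftIf-cong (rank-<ᵇ L z prev Lz) (λ j →
      trans (count-arrangedAfter k (remove L (suc z)) (suc z) j n rank-rest)
            (cong (λ r → Eul k r j) (rank-remove-below L z z ≤-refl))) i)
    where
    rank-rest : rank (remove L (suc z)) n ≡ k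
    rank-rest = suc-injective (trans (sym (rank-remove L z n Lz z<n)) rank≡)
  absent : ∀ z → z < n → L (suc z) ≡ false → count (starting (suc z)) (words k n) ≡ 0
  absent z _ = count-arrangedAfter-absent L prev i (suc z) (words k n)

Aℕ≡Eul : ∀ s a k → k ≤ s → Aℕ (suc s) a (suc k) ≡ Eul s k a
Aℕ≡Eul s a k k≤s = begin
  Aℕ (suc s) a (suc k)                                          ≡⟨ count-filter unique? q (words (suc s) (suc s)) ⟩
  count (λ σ → does (unique? σ) ∧ q σ) (words (suc s) (suc s)) ≡⟨ count-words-suc _ s (suc s) ⟩
  ∑ (suc s) (λ z → count (starts z) W)                          ≡⟨ ∑-single (s≤s k≤s) (λ z _ → count-none′) ⟩
  count (starts k) W                                            ≡⟨ count-cong first-fixed W ⟩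
  count (arrangedAfter L₀ (suc k) a) W                          ≡⟨ count-arrangedAfter s L₀ (suc k) a (suc s) rank-L₀ ⟩
  Eul s (rank L₀ k) a                                           ≡⟨ cong (λ r → Eul s r a) rank-L₀-below ⟩
  Eul s k a                                                     ∎
  where
  open ≡-Reasoning
  q : List ℕ → Bool
  q σ = firstIs (suc k) σ ∧ (des σ ≡ᵇ a)
  W : List (List ℕ)
  W = words s (suc s)
  starts : ℕ → List ℕ → Bool
  starts z w = does (unique? (suc z ∷ w)) ∧ q (suc z ∷ w)
  L₀ : ℕ → Bool
  L₀ = remove (λ _ → true) (suc k)
  count-none′ : ∀ {z} → z ≢ k → count (starts z) W ≡ 0
  count-none′ {z} z≢k = count-none (λ w →
    trans (cong (λ b → does (unique? (suc z ∷ w)) ∧ (b ∧ (des (suc z ∷ w) ≡ᵇ a))) (≡ᵇ-false z≢k))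
          (∧-zeroʳ (does (unique? (suc z ∷ w))))) W
  first-fixed : ∀ w → starts k w ≡ arrangedAfter L₀ (suc k) a w
  first-fixed w = cong₂ _∧_ (unique≡arranged (suc k ∷ w)) (cong (_∧ (des (suc k ∷ w) ≡ᵇ a)) (≡ᵇ-refl k))
  rank-L₀ : rank L₀ (suc s) ≡ s
  rank-L₀ = suc-injective (trans (sym (rank-remove (λ _ → true) k (suc s) refl (s≤s k≤s))) (rank-all (suc s)))
  rank-L₀-below : rank L₀ k ≡ k
  rank-L₀-below = trans (rank-remove-below (λ _ → true) k k ≤-refl) (rank-all k)

-- Weakly increasing lists

data Ascent (b : ℕ) : List ℕ → ℕ → Set where
  [_] : ∀ {c} → b ≤ c → Ascent b [] c
  _∷_ : ∀ {x xs c} → b ≤ x → Ascent x xs c → Ascent b (x ∷ xs) c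

Ascent-++ : ∀ {b c e xs ys} → Ascent b xs c → Ascent c ys e → Ascent b (xs ++ ys) e
Ascent-++ [ b≤c ]     [ c≤e ]     = [ ≤-trans b≤c c≤e ]
Ascent-++ [ b≤c ]     (c≤y ∷ ys↑) = ≤-trans b≤c c≤y ∷ ys↑
Ascent-++ (b≤x ∷ xs↑) ys↑         = b≤x ∷ Ascent-++ xs↑ ys↑

Ascent⇒Linked : ∀ {b c xs} → Ascent b xs c → Linked _≤_ (b ∷ xs)
Ascent⇒Linked [ _ ]       = [-]
Ascent⇒Linked (b≤x ∷ xs↑) = b≤x ∷ Ascent⇒Linked xs↑

Ascent-Linked : ∀ {b c xs ys} → Ascent b xs c → Linked _≤_ (c ∷ ys) → Linked _≤_ (b ∷ xs ++ ys)
Ascent-Linked [ b≤c ]     [-]         = [-]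
Ascent-Linked [ b≤c ]     (c≤y ∷ ys↑) = ≤-trans b≤c c≤y ∷ ys↑
Ascent-Linked (b≤x ∷ xs↑) ys↑         = b≤x ∷ Ascent-Linked xs↑ ys↑

applyDownFrom-Ascent : ∀ (f : ℕ → ℕ) n {c} → (∀ j → j < n → f (suc j) ≤ f j) → f 0 ≤ c →
                       Ascent (f n) (applyDownFrom f n) c
applyDownFrom-Ascent f zero    step f0≤c = [ f0≤c ]
applyDownFrom-Ascent f (suc n) step f0≤c =
  step n ≤-refl ∷ applyDownFrom-Ascent f n (λ j j<n → step j (m<n⇒m<1+n j<n)) f0≤c

take-applyDownFrom-Ascent : ∀ (f : ℕ → ℕ) n t → (∀ j → j < n → n ≤ j + t → f (suc j) ≤ f j) →
                            Ascent (f n) (take t (applyDownFrom f n)) (f (n ∸ t))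
take-applyDownFrom-Ascent f n       zero    step = [ ≤-refl ]
take-applyDownFrom-Ascent f zero    (suc t) step = [ ≤-refl ]
take-applyDownFrom-Ascent f (suc n) (suc t) step =
  step n ≤-refl (≤-trans (s≤s (m≤m+n n t)) (≤-reflexive (sym (+-suc n t)))) ∷
  take-applyDownFrom-Ascent f n t (λ j j<n n≤j+t →
    step j (m<n⇒m<1+n j<n) (≤-trans (s≤s n≤j+t) (≤-reflexive (sym (+-suc j t)))))

concat-Ascent : ∀ (xs : ℕ → List ℕ) (g : ℕ → ℕ) m → (∀ i → i < m → Ascent (g i) (xs i) (g (suc i))) →
                Ascent (g 0) (concat (applyUpTo xs m)) (g m)
concat-Ascent xs g zero    _   = [ ≤-refl ]
concat-Ascent xs g (suc m) xs↑ =
  Ascent-++ (xs↑ 0 z<s) (concat-Ascent (xs ∘ suc) (g ∘ suc) m (λ i i<m → xs↑ (suc i) (s<s i<m)))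

map-applyDownFrom : ∀ {A B : Set} (f : A → B) g n → map f (applyDownFrom g n) ≡ applyDownFrom (f ∘ g) n
map-applyDownFrom f g zero    = refl
map-applyDownFrom f g (suc n) = cong (f (g n) ∷_) (map-applyDownFrom f g n)

col : ℕ → ℤ
col zero    = -[1+ 0 ]
col (suc j) = ℤ.+ j

fullCols≡ : ∀ d → fullCols d ≡ applyDownFrom col (suc (suc d))
fullCols≡ zero    = refl
fullCols≡ (suc d) = cong (ℤ.+ suc d ∷_) (fullCols≡ d)

-- entry d i k = h^(d)_{i,k-1}: the columns j = d, …, -1 of a row are k = d + 1, …, 0.
entry : ℕ → ℕ → ℕ → ℕ
entry d i k = h d (ℤ.+ i) (col k)

rowHead : ℕ → ℕ → ℕ
rowHead d i = entry d i (suc d)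

row : ℕ → ℕ → List ℕ
row d i = map (h d (ℤ.+ i)) (fullCols d)

row≡ : ∀ d i → row d i ≡ applyDownFrom (entry d i) (suc (suc d))
row≡ d i = trans (cong (map (h d (ℤ.+ i))) (fullCols≡ d)) (map-applyDownFrom (h d (ℤ.+ i)) col (suc (suc d)))

entry≡Aℕ : ∀ d i k → entry d i k ≡ Aℕ (suc (suc d)) (suc i) (suc k)
entry≡Aℕ d i zero    = cong₂ (λ n a → Aℕ n a 1) (+-comm d 2) (+-comm i 1)
entry≡Aℕ d i (suc j) =
  trans (cong₂ (λ n a → Aℕ n a (j + 2)) (+-comm d 2) (+-comm i 1)) (cong (Aℕ (suc (suc d)) (suc i)) (+-comm j 2))

entry≡Eul : ∀ d i k → k ≤ suc d → entry d i k ≡ Eul (suc d) k (suc i)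
entry≡Eul d i k k≤ = trans (entry≡Aℕ d i k) (Aℕ≡Eul (suc d) (suc i) k k≤)

entry-decreasing : ∀ d i → suc i + suc i ≤ d → ∀ j → j < suc d → entry d i (suc j) ≤ entry d i j
entry-decreasing d i below j j<1+d =
  subst₂ _≤_ (sym (entry≡Eul d i (suc j) j<1+d)) (sym (entry≡Eul d i j (<⇒≤ j<1+d)))
    (Eul-decreasing-in-first d (suc i) below j j<1+d)

entry-decreasing-middle : ∀ m j → suc m ≤ j → j ≤ suc (m + m) →
                          entry (suc (m + m)) m (suc j) ≤ entry (suc (m + m)) m j
entry-decreasing-middle m j m<j j≤d =
  subst₂ _≤_ (sym (entry≡Eul d m (suc j) (s≤s j≤d))) (sym (entry≡Eul d m j (m≤n⇒m≤1+n j≤d)))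
    (Eul-decreasing-in-first-middle m m<j j≤d)
  where d = suc (m + m)

entry-next-row : ∀ d i → entry d i 0 ≡ rowHead d (suc i)
entry-next-row d i =
  trans (entry≡Eul d i 0 z≤n) (trans (Eul-first≡last d (suc i)) (sym (entry≡Eul d (suc i) (suc d) ≤-refl)))

row-Ascent : ∀ d i → suc i + suc i ≤ d → Ascent (rowHead d i) (row d i) (rowHead d (suc i))
row-Ascent d i below = subst (λ xs → Ascent (rowHead d i) xs (rowHead d (suc i))) (sym (row≡ d i))
  (≤-refl ∷ applyDownFrom-Ascent (entry d i) (suc d) (entry-decreasing d i below) (≤-reflexive (entry-next-row d i)))

rows-Ascent : ∀ d m → (∀ i → i < m → suc i + suc i ≤ d) →
              Ascent (rowHead d 0) (concat (map (row d) (upTo m))) (rowHead d m)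
rows-Ascent d m below = subst (λ xss → Ascent (rowHead d 0) (concat xss) (rowHead d m)) (sym (map-applyUpTo id (row d) m))
  (concat-Ascent (row d) (rowHead d) m (λ i i<m → row-Ascent d i (below i i<m)))

last-row-even : ∀ d m → d ≡ suc (suc (m + m)) → Linked _≤_ (rowHead d m ∷ row d m)
last-row-even d m d≡ = Ascent⇒Linked (row-Ascent d m (≤-reflexive (trans (cong suc (+-suc m m)) (sym d≡))))

last-row-odd : ∀ d m → d ≡ suc (m + m) →
               Linked _≤_ (rowHead d m ∷ map (h d (ℤ.+ m)) (take (suc (d ∸ m)) (fullCols d)))
last-row-odd .(suc (m + m)) m refl = subst (λ xs → Linked _≤_ (rowHead d m ∷ xs)) (sym prefix≡)
  (≤-refl ∷ Ascent⇒Linked (take-applyDownFrom-Ascent (entry d m) (suc d) (d ∸ m) upper-half))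
  where
  d = suc (m + m)
  prefix≡ : map (h d (ℤ.+ m)) (take (suc (d ∸ m)) (fullCols d))
              ≡ take (suc (d ∸ m)) (applyDownFrom (entry d m) (suc (suc d)))
  prefix≡ = trans (sym (take-map (suc (d ∸ m)) (fullCols d))) (cong (take (suc (d ∸ m))) (row≡ d m))
  d∸m≡ : d ∸ m ≡ suc m
  d∸m≡ = trans (+-∸-assoc 1 (m≤m+n m m)) (cong suc (m+n∸m≡n m m))
  upper-half : ∀ j → j < suc d → suc d ≤ j + (d ∸ m) → entry d m (suc j) ≤ entry d m j
  upper-half j j<1+d 1+d≤ = entry-decreasing-middle m j m<j (≤-pred j<1+d)
    where
    m<j : suc m ≤ j
    m<j = +-cancelʳ-≤ m (suc m) j (≤-pred (subst (suc d ≤_) (trans (cong (j +_) d∸m≡) (+-suc j m)) 1+d≤))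

m*2≡m+m : ∀ m → m * 2 ≡ m + m
m*2≡m+m m = trans (*-comm m 2) (cong (m +_) (+-identityʳ m))

parity-cases : ∀ e → (e ≡ e / 2 + e / 2 × suc e % 2 ≡ 1) ⊎ (e ≡ suc (e / 2 + e / 2) × suc e % 2 ≡ 0)
parity-cases e with e % 2 | m%n<n e 2 | m≡m%n+[m/n]*n e 2
... | zero        | _            | e≡ =
  inj₁ (trans e≡ (m*2≡m+m (e / 2)) , trans (cong (λ x → suc x % 2) e≡) ([m+kn]%n≡m%n 1 (e / 2) 2))
... | suc zero    | _            | e≡ =
  inj₂ (trans e≡ (cong suc (m*2≡m+m (e / 2))) , trans (cong (λ x → suc x % 2) e≡) ([m+kn]%n≡m%n 2 (e / 2) 2))
... | suc (suc _) | s≤s (s≤s ()) | _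

rows-below-middle : ∀ e i → i < e / 2 → suc i + suc i ≤ suc e
rows-below-middle e i i<m =
  ≤-trans (+-mono-≤ i<m i<m) (≤-trans (≤-reflexive (sym (m*2≡m+m (e / 2)))) (m≤n⇒m≤1+n (m/n*n≤m e 2)))

last-row : ∀ e → Linked _≤_ (rowHead (suc e) (e / 2) ∷ map (h (suc e) (ℤ.+ (e / 2))) (lastCols (suc e)))
last-row e with parity-cases e
... | inj₁ (e≡m+m , odd) rewrite odd = last-row-odd (suc e) (e / 2) (cong suc e≡m+m)
... | inj₂ (e≡1+m+m , even) rewrite even = last-row-even (suc e) (e / 2) (cong suc e≡1+m+m)

lemma2p13 : (d : ℕ) → 1 ≤ d → Linked _≤_ (chain d)
lemma2p13 (suc e) _ = tail (Ascent-Linked (rows-Ascent (suc e) (e / 2) (rows-below-middle e)) (last-row e))
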